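{- For every integer $n\ge3$, $\chi'_{\rm OCF}(K_n)>\log_2 n-\log_2\log_2 n-1$, where $K_n$ is the complete graph on $n$ vertices.
   Context: For an edge colouring $c:E\to\mathbb{N}$ of a graph $G=(V,E)$ (not necessarily proper) and an edge $uv$, the open neighbourhood is $E_G(uv)=(E_G(u)\cup E_G(v))\setminus\{uv\}$, where $E_G(x)$ is the set of edges incident with $x$; $uv$ is satisfied if some colour appears on exactly one edge of $E_G(uv)$. The colouring is open conflict-free if every non-isolated edge is satisfied, and $\chi'_{\rm OCF}(G)$ is the minimum number of colours of such a colouring. -}

module Defs where

open import Data.Nat using (ℕ; _+_)
open import Data.Fin using (Fin; _≟_)
open import Data.List using (List; length; filter; allFin)
open import Data.Product using (∃; _×_)
open import Relation.Nullary using (¬_; ¬?)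
open import Relation.Nullary.Decidable using (_×-dec_)
open import Relation.Binary.PropositionalEquality using (_≡_; _≢_)

-- The edge {u,v} (u ≢ v) gets colour
-- c u v; we require symmetry so the colouring is one of unordered edges.
-- Values c u u are irrelevant (there are no loops).
record EdgeColouring (n k : ℕ) : Set where
  field
    col : Fin n → Fin n → Fin k
    sym : ∀ u v → col u v ≡ col v u
open EdgeColouring public

countAt : ∀ {n k} → EdgeColouring n k → Fin n → Fin n → Fin k → ℕ
countAt c u v a =
  length (filter (λ w → ¬? (w ≟ u) ×-dec (¬? (w ≟ v) ×-dec (col c u w ≟ a))) (allFin _))

-- Number of edges in the open neighbourhood E(uv) = (E(u) ∪ E(v)) \ {uv}
-- of K_n having colour a.  (The edges u w and v w, w ∉ {u,v}, are distinct.)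
occurrences : ∀ {n k} → EdgeColouring n k → Fin n → Fin n → Fin k → ℕ
occurrences c u v a = countAt c u v a + countAt c v u a

Satisfied : ∀ {n k} → EdgeColouring n k → Fin n → Fin n → Set
Satisfied c u v = ∃ λ a → occurrences c u v a ≡ 1

NonIsolated : ∀ {n} → Fin n → Fin n → Set
NonIsolated {n} u v = ∃ λ (w : Fin n) → (w ≢ u) × (w ≢ v)

OpenConflictFree : ∀ {n k} → EdgeColouring n k → Set
OpenConflictFree {n} c = ∀ (u v : Fin n) → u ≢ v → NonIsolated u v → Satisfied c u v

{-# OPTIONS --safe #-}
-- For each vertex u record the parities of its colour degrees, a vector in
-- (ℤ/2)^k.  For an edge uv and a colour a, the degrees of a at u and at v sum
-- to the number of a-edges in E(uv) plus twice the indicator of c(uv) = a.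
-- So if u and v had the same parity vector, every colour would occur an even
-- number of times on E(uv) and uv could not be satisfied.  Hence an open
-- conflict-free colouring makes u ↦ parity vector injective, n ≤ 2^k, and
-- 2^n ≤ 2^(2^k) < 2^(2^(k+1)) ≤ n^(2^(k+1)).
module Submission where

open import Defs renaming (sym to col-sym)
open import Data.Nat using (ℕ; suc; _≤_; _<_; _^_; _+_; _*_; _%_; s≤s)
open import Data.Nat.Properties
  using (+-comm; +-identityʳ; ≤-refl; ≤-trans; n≤1+n; n<1+n; ^-monoʳ-≤; ^-monoʳ-<; ^-monoˡ-≤;
         module ≤-Reasoning)
open import Data.Nat.DivMod using (_mod_; %-distribˡ-+; m*n%n≡0; [m+kn]%n≡m%n)
open import Data.Nat.Solver using (module +-*-Solver)
open import Data.Bool using (if_then_else_; not; _∧_)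
open import Data.Fin using (Fin; _≟_; toℕ; funToFin; finToFun) renaming (zero to fzero; suc to fsuc)
open import Data.Fin.Properties using (toℕ-fromℕ<; finToFun-funToFin; injective⇒≤)
open import Data.List using ([]; _∷_; length; filter; allFin)
open import Data.List.Properties using (filter-≐)
open import Data.List.Relation.Unary.All using (All; []; _∷_)
open import Data.List.Relation.Unary.Any using (here; there)
open import Data.List.Relation.Unary.AllPairs using (_∷_)
open import Data.List.Membership.Propositional using (_∈_)
open import Data.List.Membership.Propositional.Properties using (∈-allFin)
open import Data.List.Relation.Unary.Unique.Propositional using (Unique)
open import Data.List.Relation.Unary.Unique.Propositional.Properties using (allFin⁺)
open import Data.Product using (_×_; _,_)
open import Function using (_∘_)
open import Function.Definitions using (Injective)
open import Level using (Level)
open import Relation.Binary.Definitions using (DecidableEquality)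
open import Relation.Binary.PropositionalEquality
open import Relation.Nullary using (Dec; does; yes; no; ¬?; contradiction)
open import Relation.Nullary.Decidable using (_×-dec_; dec-false)
open import Relation.Unary using (Pred; Decidable)

indicator : ∀ {ℓ} {A : Set ℓ} → Dec A → ℕ
indicator a? = if does a? then 1 else 0

module _ {a p : Level} {A : Set a} (_≟ᴬ_ : DecidableEquality A) {P : Pred A p} (P? : Decidable P) where

  filter-without-fresh : ∀ {x} xs → All (x ≢_) xs →
                         filter (λ y → ¬? (y ≟ᴬ x) ×-dec P? y) xs ≡ filter P? xs
  filter-without-fresh []       []           = refl
  filter-without-fresh {x} (y ∷ ys) (x≢y ∷ x∉ys) with y ≟ᴬ x | P? y
  ... | yes y≡x | _     = contradiction (sym y≡x) x≢y
  ... | no _    | yes _ = cong (y ∷_) (filter-without-fresh ys x∉ys)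
  ... | no _    | no _  = filter-without-fresh ys x∉ys

  length-filter-split : ∀ {x} xs → Unique xs → x ∈ xs →
                        length (filter P? xs) ≡
                        length (filter (λ y → ¬? (y ≟ᴬ x) ×-dec P? y) xs) + indicator (P? x)
  length-filter-split {x} (y ∷ _) _ _ with y ≟ᴬ x
  length-filter-split (x ∷ ys) (x∉ys ∷ _) _ | yes refl
    rewrite filter-without-fresh ys x∉ys with P? x
  ... | yes _ = +-comm 1 _
  ... | no _  = sym (+-identityʳ _)
  length-filter-split (y ∷ ys) (_ ∷ uys) x∈xs | no y≢x with P? y | x∈xs
  ... | _     | here x≡y   = contradiction (sym x≡y) y≢x
  ... | yes _ | there x∈ys = cong suc (length-filter-split ys uys x∈ys)
  ... | no _  | there x∈ys = length-filter-split ys uys x∈ys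

m%2≡n%2⇒[m+n]%2≡0 : ∀ {m n} → m % 2 ≡ n % 2 → (m + n) % 2 ≡ 0
m%2≡n%2⇒[m+n]%2≡0 {m} {n} m%2≡n%2 = begin
  (m + n) % 2             ≡⟨ %-distribˡ-+ m n 2 ⟩
  (m % 2 + n % 2) % 2     ≡⟨ cong (λ r → (r + n % 2) % 2) m%2≡n%2 ⟩
  (n % 2 + n % 2) % 2     ≡⟨ cong (_% 2) (solve 1 (λ r → r :+ r := r :* con 2) refl (n % 2)) ⟩
  (n % 2 * 2) % 2         ≡⟨ m*n%n≡0 (n % 2) 2 ⟩
  0 ∎
  where
  open ≡-Reasoning
  open +-*-Solver

module _ {n k : ℕ} (c : EdgeColouring n k) where

  degree : Fin n → Fin k → ℕ
  degree u a = length (filter (λ w → ¬? (w ≟ u) ×-dec (col c u w ≟ a)) (allFin n))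

  degree≡countAt+indicator : ∀ {u v} a → v ≢ u →
                             degree u a ≡ countAt c u v a + indicator (col c u v ≟ a)
  degree≡countAt+indicator {u} {v} a v≢u = begin
    degree u a
      ≡⟨ length-filter-split _≟_ P? (allFin n) (allFin⁺ n) (∈-allFin v) ⟩
    length (filter (λ w → ¬? (w ≟ v) ×-dec P? w) (allFin n)) + indicator (P? v)
      ≡⟨ cong₂ _+_ (cong length (filter-≐ _ _ (swap , swap) (allFin n))) v-passes ⟩
    countAt c u v a + indicator (col c u v ≟ a) ∎
    where
    open ≡-Reasoning
    P? = λ w → ¬? (w ≟ u) ×-dec (col c u w ≟ a)
    swap : ∀ {A B C : Set} → A × (B × C) → B × (A × C)
    swap (x , y , z) = y , x , z
    v-passes : indicator (P? v) ≡ indicator (col c u v ≟ a)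
    v-passes = cong (λ b → if not b ∧ does (col c u v ≟ a) then 1 else 0) (dec-false (v ≟ u) v≢u)

  degree+degree≡occurrences+indicator*2 :
    ∀ {u v} a → u ≢ v →
    degree u a + degree v a ≡ occurrences c u v a + indicator (col c u v ≟ a) * 2
  degree+degree≡occurrences+indicator*2 {u} {v} a u≢v = begin
    degree u a + degree v a
      ≡⟨ cong₂ _+_ (degree≡countAt+indicator a (u≢v ∘ sym)) (degree≡countAt+indicator a u≢v) ⟩
    (x + e) + (y + indicator (col c v u ≟ a))
      ≡⟨ cong (λ d → (x + e) + (y + indicator (d ≟ a))) (col-sym c v u) ⟩
    (x + e) + (y + e)
      ≡⟨ solve 3 (λ x y e → (x :+ e) :+ (y :+ e) := (x :+ y) :+ e :* con 2) refl x y e ⟩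
    (x + y) + e * 2 ∎
    where
    open ≡-Reasoning
    open +-*-Solver
    x = countAt c u v a
    y = countAt c v u a
    e = indicator (col c u v ≟ a)

  occurrences%2≡0 : ∀ {u v} a → u ≢ v → degree u a % 2 ≡ degree v a % 2 →
                    occurrences c u v a % 2 ≡ 0
  occurrences%2≡0 {u} {v} a u≢v same-parity = begin
    occurrences c u v a % 2
      ≡⟨ [m+kn]%n≡m%n (occurrences c u v a) e 2 ⟨
    (occurrences c u v a + e * 2) % 2
      ≡⟨ cong (_% 2) (degree+degree≡occurrences+indicator*2 a u≢v) ⟨
    (degree u a + degree v a) % 2
      ≡⟨ m%2≡n%2⇒[m+n]%2≡0 {degree u a} same-parity ⟩
    0 ∎
    where
    open ≡-Reasoning
    e = indicator (col c u v ≟ a)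

  parityCode : Fin n → Fin (2 ^ k)
  parityCode u = funToFin (λ a → degree u a mod 2)

  parityCode-parity : ∀ u a → toℕ (finToFun (parityCode u) a) ≡ degree u a % 2
  parityCode-parity u a =
    trans (cong toℕ (finToFun-funToFin (λ b → degree u b mod 2) a)) (toℕ-fromℕ< _)

  parityCode-injective : (∀ u v → NonIsolated u v) → OpenConflictFree c →
                         Injective _≡_ _≡_ parityCode
  parityCode-injective non-isolated ocf {u} {v} same-code with u ≟ v
  ... | yes u≡v = u≡v
  ... | no u≢v  with ocf u v u≢v (non-isolated u v)
  ...   | a , once = contradiction (trans (cong (_% 2) (sym once)) occurrences-even) λ ()
    where
    same-parity : degree u a % 2 ≡ degree v a % 2
    same-parity = begin
      degree u a % 2                        ≡⟨ parityCode-parity u a ⟨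
      toℕ (finToFun (parityCode u) a)       ≡⟨ cong (λ f → toℕ (finToFun f a)) same-code ⟩
      toℕ (finToFun (parityCode v) a)       ≡⟨ parityCode-parity v a ⟩
      degree v a % 2 ∎
      where open ≡-Reasoning
    occurrences-even = occurrences%2≡0 a u≢v same-parity

nonIsolated : ∀ {m} (u v : Fin (3 + m)) → NonIsolated u v
nonIsolated fzero           fzero           = fsuc fzero , (λ ()) , (λ ())
nonIsolated fzero           (fsuc fzero)    = fsuc (fsuc fzero) , (λ ()) , (λ ())
nonIsolated fzero           (fsuc (fsuc _)) = fsuc fzero , (λ ()) , (λ ())
nonIsolated (fsuc fzero)    fzero           = fsuc (fsuc fzero) , (λ ()) , (λ ())
nonIsolated (fsuc (fsuc _)) fzero           = fsuc fzero , (λ ()) , (λ ())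
nonIsolated (fsuc _)        (fsuc _)        = fzero , (λ ()) , (λ ())

vertices≤2^colours : ∀ {n k} → 3 ≤ n → (c : EdgeColouring n k) → OpenConflictFree c → n ≤ 2 ^ k
vertices≤2^colours (s≤s (s≤s (s≤s _))) c ocf = injective⇒≤ (parityCode-injective c nonIsolated ocf)

2^n<n^2^[1+k] : ∀ {n k} → 2 ≤ n → n ≤ 2 ^ k → 2 ^ n < n ^ (2 ^ suc k)
2^n<n^2^[1+k] {n} {k} 2≤n n≤2^k = begin-strict
  2 ^ n           ≤⟨ ^-monoʳ-≤ 2 n≤2^k ⟩
  2 ^ 2 ^ k       <⟨ ^-monoʳ-< 2 ≤-refl (^-monoʳ-< 2 ≤-refl (n<1+n k)) ⟩
  2 ^ 2 ^ suc k   ≤⟨ ^-monoˡ-≤ (2 ^ suc k) 2≤n ⟩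
  n ^ 2 ^ suc k   ∎
  where open ≤-Reasoning

mainTheorem8 : ∀ (n k : ℕ) → 3 ≤ n → (c : EdgeColouring n k) → OpenConflictFree c →
                 2 ^ n < n ^ (2 ^ suc k)
mainTheorem8 n k 3≤n c ocf =
  2^n<n^2^[1+k] {k = k} (≤-trans (n≤1+n 2) 3≤n) (vertices≤2^colours 3≤n c ocf)
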